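{- For every $n\ge 0$, $$G_{n+1}(x_1,x_2;y_1,y_2)=\sum_{i=0}^{n}\binom{n}{i}y_2^i\,M_{n-i}(x_1y_1;x_2).$$
   Context: A plane tree is an unlabeled rooted tree in which the children of every vertex are linearly ordered from left to right; $\mathcal{P}_n$ is the set of plane trees with $n$ edges. A leaf is a vertex with no children, an interior vertex one with at least one child. A leaf is an old leaf if it is the leftmost child of its parent (including a leaf that is the only child), and a young leaf otherwise. For $T\in\mathcal P_n$, $\mathrm{oleaf}(T),\mathrm{yleaf}(T)$ are the numbers of old and young leaves, $\mathrm{oint}(T)$ the number of interior vertices that are parents of old leaves, $\mathrm{yint}(T)$ the number of interior vertices that are not parents of old leaves. For $n\ge1$, $G_n(x_1,x_2;y_1,y_2)=\sum_{T\in\mathcal P_n}x_1^{\mathrm{oleaf}(T)}x_2^{\mathrm{yleaf}(T)}y_1^{\mathrm{oint}(T)}y_2^{\mathrm{yint}(T)}$. The Motzkin polynomials are $M_n(u;v)=\sum_{k=0}^{\lfloor n/2\rfloor}\binom{n}{2k}C_k u^{k+1}v^{n-2k}$, with $C_k=\frac{1}{k+1}\binom{2k}{k}$. -}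

module Defs where

open import Level using (Level)
open import Data.Nat.Base as ℕ using (ℕ; zero; suc; _+_; _*_; _∸_; _/_)
open import Data.Nat.Combinatorics using (_C_)
open import Data.List.Base using (List; []; _∷_; length)
open import Algebra.Bundles using (CommutativeSemiring)

data PlaneTree : Set where
  node : List PlaneTree → PlaneTree

leafInd : PlaneTree → ℕ
leafInd (node [])      = 1
leafInd (node (_ ∷ _)) = 0

nonLeafInd : PlaneTree → ℕ
nonLeafInd (node [])      = 0
nonLeafInd (node (_ ∷ _)) = 1

countLeafRoots : List PlaneTree → ℕ
countLeafRoots []       = 0
countLeafRoots (t ∷ ts) = leafInd t + countLeafRoots ts

mutual
  edges : PlaneTree → ℕ
  edges (node ts) = length ts + edgesL ts

  edgesL : List PlaneTree → ℕ
  edgesL []       = 0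
  edgesL (t ∷ ts) = edges t + edgesL ts

-- old leaves: leaves that are the leftmost child of their parent
mutual
  oleaf : PlaneTree → ℕ
  oleaf (node [])       = 0
  oleaf (node (c ∷ cs)) = leafInd c + oleafL (c ∷ cs)

  oleafL : List PlaneTree → ℕ
  oleafL []       = 0
  oleafL (t ∷ ts) = oleaf t + oleafL ts

-- young leaves: leaves that are not the leftmost child of their parent
mutual
  yleaf : PlaneTree → ℕ
  yleaf (node [])       = 0
  yleaf (node (c ∷ cs)) = countLeafRoots cs + yleafL (c ∷ cs)

  yleafL : List PlaneTree → ℕ
  yleafL []       = 0
  yleafL (t ∷ ts) = yleaf t + yleafL ts

-- interior vertices that are parents of old leaves
-- (an interior vertex is the parent of an old leaf iff its leftmost child is a leaf)
mutual
  oint : PlaneTree → ℕ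
  oint (node [])       = 0
  oint (node (c ∷ cs)) = leafInd c + ointL (c ∷ cs)

  ointL : List PlaneTree → ℕ
  ointL []       = 0
  ointL (t ∷ ts) = oint t + ointL ts

mutual
  yint : PlaneTree → ℕ
  yint (node [])       = 0
  yint (node (c ∷ cs)) = nonLeafInd c + yintL (c ∷ cs)

  yintL : List PlaneTree → ℕ
  yintL []       = 0
  yintL (t ∷ ts) = yint t + yintL ts

catalan : ℕ → ℕ
catalan k = ((2 * k) C k) / suc k

-- Polynomial identities are stated in an arbitrary commutative semiring
-- (equivalent to identities in ℕ[x₁,x₂,y₁,y₂] by its universal property).
module Poly {c ℓ : Level} (R : CommutativeSemiring c ℓ) where
  open CommutativeSemiring R using (rawSemiring; 0#; 1#) renaming (Carrier to A; _+_ to _+ᴿ_; _*_ to _*ᴿ_)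
  open import Algebra.Definitions.RawSemiring rawSemiring using (_×_; _^_)

  sumUpTo : (ℕ → A) → ℕ → A
  sumUpTo f zero    = f zero
  sumUpTo f (suc m) = sumUpTo f m +ᴿ f (suc m)

  sumList : {B : Set} → (B → A) → List B → A
  sumList f []       = 0#
  sumList f (b ∷ bs) = f b +ᴿ sumList f bs

  weight : A → A → A → A → PlaneTree → A
  weight x₁ x₂ y₁ y₂ T =
    (((x₁ ^ oleaf T) *ᴿ (x₂ ^ yleaf T)) *ᴿ (y₁ ^ oint T)) *ᴿ (y₂ ^ yint T)

  -- G over a given (duplicate-free, complete) listing of 𝒫ₙ
  G : List PlaneTree → A → A → A → A → A
  G Ts x₁ x₂ y₁ y₂ = sumList (weight x₁ x₂ y₁ y₂) Ts

  motzkin : ℕ → A → A → A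
  motzkin n u v =
    sumUpTo (λ k → ((n C (2 ℕ.* k)) × (catalan k × 1#)) *ᴿ ((u ^ suc k) *ᴿ (v ^ (n ∸ 2 ℕ.* k)))) (n / 2)

{-# OPTIONS --safe #-}
-- Read a list of s non-leaf plane trees as a lattice path at height s. A list with n + 1 edges
-- and s + 1 trees comes from a unique list with n edges by one move on its first tree:
-- prepending the one-edge tree (weight x₁y₁, from s trees), putting the first tree under a new
-- root (weight y₂) or giving its root a young leaf as second child (weight x₂, both from s + 1
-- trees), or grafting the second tree there (weight 1, from s + 2 trees). So the weight sums of
-- these lists obey the recurrence of Motzkin paths with down-steps x₁y₁, level steps x₂ + y₂ and
-- up-steps 1, and G_{n+1}, the sum over single trees, is x₁y₁ times the weighted count of Motzkin
-- paths of length n from height 0 to 0. Expanding the level weight x₂ + y₂ binomially, and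
-- counting the up/down skeletons by ballot numbers, which at height 0 are Catalan numbers by the
-- reflection principle, gives the formula.
module Submission where

open import Level using (Level)
open import Data.Nat.Base as ℕ using (ℕ; zero; suc; _∸_; ⌊_/2⌋)
import Data.Nat.Properties as ℕ
open import Data.Nat.Combinatorics using (_C_)
open import Data.Nat.Tactic.RingSolver using (solve-∀)
open import Data.List.Base using (List; []; _∷_; [_]; length; map; concat)
open import Data.List.Membership.Propositional using (_∈_)
open import Data.List.Relation.Unary.All as All using (All; []; _∷_)
open import Data.List.Relation.Unary.Unique.Propositional using (Unique)
open import Data.List.Relation.Binary.Permutation.Propositional using (_↭_)
open import Function.Base using (_∘_)
open import Relation.Binary.PropositionalEquality as ≡ using (_≡_)
open import Algebra.Bundles using (CommutativeSemiring)
import Algebra.Definitions.RawSemiring as RS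
open import Defs

module BallotNumbers where

  open import Data.Nat.Base using (_+_; _*_; _/_; _<_; _≤_; s≤s; _!)
  open import Data.Nat.Properties
  open import Data.Nat.Combinatorics
    using (nCk+nC[k+1]≡[n+1]C[k+1]; k>n⇒nCk≡0; nCn≡1; nCk≡nC[n∸k]; nCk≡n!/k![n-k]!; k![n∸k]!∣n!;
           [n-k]*d[k+1]≡[k+1]*d[k])
  open import Data.Nat.DivMod using (m*n/n≡m; m/n*n≡m)
  open import Relation.Binary.PropositionalEquality
  open import Relation.Nullary using (yes; no)

  -- ballot j h counts the ±1 paths of length j from height h to height 0 that never go below 0.
  ballot : ℕ → ℕ → ℕ
  ballot zero    zero    = 1
  ballot zero    (suc h) = 0
  ballot (suc j) zero    = ballot j 1
  ballot (suc j) (suc h) = ballot j h + ballot j (2 + h)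

  ballot-below : ∀ {j h} → j < h → ballot j h ≡ 0
  ballot-below {zero}  {suc h} _         = refl
  ballot-below {suc j} {suc h} (s≤s j<h) =
    cong₂ _+_ (ballot-below j<h) (ballot-below (m<n⇒m<1+n (m<n⇒m<1+n j<h)))

  ballot-diag : ∀ h → ballot h h ≡ 1
  ballot-diag zero    = refl
  ballot-diag (suc h) = cong₂ _+_ (ballot-diag h) (ballot-below (m<n⇒m<1+n (n<1+n h)))

  ballot-odd : ∀ j h q → j + h ≡ suc (q + q) → ballot j h ≡ 0
  ballot-odd zero    zero    q       ()
  ballot-odd zero    (suc h) q       _  = refl
  ballot-odd (suc j) zero    q       eq = ballot-odd j 1 q (trans (+-suc j 0) eq)
  ballot-odd (suc j) (suc h) zero    eq with () ← trans (sym (+-suc j h)) (suc-injective eq)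
  ballot-odd (suc j) (suc h) (suc q) eq =
    cong₂ _+_ (ballot-odd j h q j+h≡) (ballot-odd j (2 + h) (suc q) (trans (+-suc j (suc h)) (cong suc j+1+h≡)))
    where
      j+1+h≡ : j + suc h ≡ suc (q + suc q)
      j+1+h≡ = suc-injective eq
      j+h≡ : j + h ≡ suc (q + q)
      j+h≡ = suc-injective (trans (sym (+-suc j h)) (trans j+1+h≡ (cong suc (+-suc q q))))

  -- The reflection principle, for paths with a up-steps and d down-steps.
  ballot-reflection : ∀ {a h d m} → d ≡ a + h → m ≡ a + d → ballot m h + m C suc d ≡ m C d
  ballot-reflection {zero} {h} refl refl =
    trans (cong₂ _+_ (ballot-diag h) (k>n⇒nCk≡0 (n<1+n h))) (sym (nCn≡1 h))
  ballot-reflection {suc a} {_}     {_} {zero}  _  ()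
  ballot-reflection {suc a} {zero}  {d} {suc m} d≡ m+1≡ with trans d≡ (+-identityʳ (suc a))
  ... | refl = begin
    ballot m 1 + suc m C (2 + a)             ≡⟨ cong (ballot m 1 +_) (nCk+nC[k+1]≡[n+1]C[k+1] m (suc a)) ⟨
    ballot m 1 + (m C suc a + m C (2 + a))   ≡⟨ x+[y+z]≡y+[x+z] (ballot m 1) (m C suc a) (m C (2 + a)) ⟩
    m C suc a + (ballot m 1 + m C (2 + a))   ≡⟨ cong (m C suc a +_) (ballot-reflection (+-comm 1 a) m≡a+[1+a]) ⟩
    m C suc a + m C suc a                    ≡⟨ cong (_+ m C suc a) middle-symmetric ⟩
    m C a + m C suc a                        ≡⟨ nCk+nC[k+1]≡[n+1]C[k+1] m a ⟩
    suc m C suc a                            ∎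
    where
      open ≡-Reasoning
      x+[y+z]≡y+[x+z] : ∀ x y z → x + (y + z) ≡ y + (x + z)
      x+[y+z]≡y+[x+z] = solve-∀
      m≡a+[1+a] : m ≡ a + suc a
      m≡a+[1+a] = suc-injective m+1≡
      m≡[1+a]+a : m ≡ suc a + a
      m≡[1+a]+a = trans m≡a+[1+a] (+-comm a (suc a))
      middle-symmetric : m C suc a ≡ m C a
      middle-symmetric = trans (nCk≡nC[n∸k] (subst (suc a ≤_) (sym m≡[1+a]+a) (m≤m+n (suc a) a)))
                               (cong (m C_) (trans (cong (_∸ suc a) m≡[1+a]+a) (m+n∸m≡n (suc a) a)))
  ballot-reflection {suc a} {suc h} {.(suc (a + suc h))} {suc m} refl m+1≡ = begin
    (ballot m h + ballot m (2 + h)) + suc m C (2 + e)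
      ≡⟨ cong (ballot m h + ballot m (2 + h) +_) (nCk+nC[k+1]≡[n+1]C[k+1] m (suc e)) ⟨
    (ballot m h + ballot m (2 + h)) + (m C suc e + m C (2 + e))
      ≡⟨ [x+y]+[z+w]≡[x+z]+[y+w] (ballot m h) (ballot m (2 + h)) (m C suc e) (m C (2 + e)) ⟩
    (ballot m h + m C suc e) + (ballot m (2 + h) + m C (2 + e))
      ≡⟨ cong₂ _+_ (ballot-reflection (+-suc a h) (trans m≡ (+-suc a e)))
                   (ballot-reflection (sym (+-suc a (suc h))) m≡) ⟩
    m C e + m C suc e
      ≡⟨ nCk+nC[k+1]≡[n+1]C[k+1] m e ⟩
    suc m C suc e ∎
    where
      open ≡-Reasoning
      e = a + suc h
      [x+y]+[z+w]≡[x+z]+[y+w] : ∀ x y z w → (x + y) + (z + w) ≡ (x + z) + (y + w)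
      [x+y]+[z+w]≡[x+z]+[y+w] = solve-∀
      m≡ : m ≡ a + suc e
      m≡ = suc-injective m+1≡

  nCk*k!*[n∸k]!≡n! : ∀ {n k} → k ≤ n → (n C k) * (k ! * (n ∸ k) !) ≡ n !
  nCk*k!*[n∸k]!≡n! {n} {k} k≤n =
    trans (cong (_* (k ! * (n ∸ k) !)) (nCk≡n!/k![n-k]! k≤n)) (m/n*n≡m (k![n∸k]!∣n! k≤n))
    where instance _ = k !* (n ∸ k) !≢0

  [k+1]*nC[k+1]≡[n∸k]*nCk : ∀ n k → suc k * (n C suc k) ≡ (n ∸ k) * (n C k)
  [k+1]*nC[k+1]≡[n∸k]*nCk n k with k <? n
  ... | no k≮n = begin
    suc k * (n C suc k) ≡⟨ cong (suc k *_) (k>n⇒nCk≡0 (s≤s (≮⇒≥ k≮n))) ⟩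
    suc k * 0           ≡⟨ *-zeroʳ (suc k) ⟩
    0                   ≡⟨ cong (_* (n C k)) (m≤n⇒m∸n≡0 (≮⇒≥ k≮n)) ⟨
    (n ∸ k) * (n C k)   ∎
    where open ≡-Reasoning
  ... | yes k<n = *-cancelʳ-≡ _ _ d {{k !* (n ∸ k) !≢0}} (begin
    suc k * (n C suc k) * d       ≡⟨ x*y*z≡y*[x*z] (suc k) (n C suc k) d ⟩
    (n C suc k) * (suc k * d)     ≡⟨ cong ((n C suc k) *_) ([n-k]*d[k+1]≡[k+1]*d[k] k<n) ⟨
    (n C suc k) * ((n ∸ k) * d′)  ≡⟨ x*[y*z]≡y*[x*z] (n C suc k) (n ∸ k) d′ ⟩
    (n ∸ k) * ((n C suc k) * d′)  ≡⟨ cong ((n ∸ k) *_) (nCk*k!*[n∸k]!≡n! k<n) ⟩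
    (n ∸ k) * n !                 ≡⟨ cong ((n ∸ k) *_) (nCk*k!*[n∸k]!≡n! (<⇒≤ k<n)) ⟨
    (n ∸ k) * ((n C k) * d)       ≡⟨ *-assoc (n ∸ k) (n C k) d ⟨
    (n ∸ k) * (n C k) * d         ∎)
    where
      open ≡-Reasoning
      d d′ : ℕ
      d  = k ! * (n ∸ k) !
      d′ = suc k ! * (n ∸ suc k) !
      x*y*z≡y*[x*z] : ∀ x y z → x * y * z ≡ y * (x * z)
      x*y*z≡y*[x*z] = solve-∀
      x*[y*z]≡y*[x*z] : ∀ x y z → x * (y * z) ≡ y * (x * z)
      x*[y*z]≡y*[x*z] = solve-∀

  ballot≡catalan : ∀ k → ballot (2 * k) 0 ≡ catalan k
  ballot≡catalan k = begin
    ballot (2 * k) 0                  ≡⟨ m*n/n≡m (ballot (2 * k) 0) (suc k) ⟨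
    ballot (2 * k) 0 * suc k / suc k  ≡⟨ cong (_/ suc k) ballot*[k+1]≡central ⟩
    central / suc k                   ∎
    where
      open ≡-Reasoning
      central next : ℕ
      central = (2 * k) C k
      next    = (2 * k) C suc k
      reflection : ballot (2 * k) 0 + next ≡ central
      reflection = ballot-reflection (sym (+-identityʳ k)) (cong (k +_) (+-identityʳ k))
      absorption : suc k * next ≡ k * central
      absorption = trans ([k+1]*nC[k+1]≡[n∸k]*nCk (2 * k) k)
                         (cong (_* central) (trans (m+n∸m≡n k (k + 0)) (+-identityʳ k)))
      ballot*[k+1]≡central : ballot (2 * k) 0 * suc k ≡ central
      ballot*[k+1]≡central = +-cancelʳ-≡ (suc k * next) _ _ (begin
        ballot (2 * k) 0 * suc k + suc k * next  ≡⟨ cong (_+ suc k * next) (*-comm (ballot (2 * k) 0) (suc k)) ⟩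
        suc k * ballot (2 * k) 0 + suc k * next  ≡⟨ *-distribˡ-+ (suc k) (ballot (2 * k) 0) next ⟨
        suc k * (ballot (2 * k) 0 + next)        ≡⟨ cong (suc k *_) reflection ⟩
        central + k * central                    ≡⟨ cong (central +_) absorption ⟨
        central + suc k * next                   ∎)

  ⌊2*n/2⌋≡n : ∀ n → ⌊ 2 * n /2⌋ ≡ n
  ⌊2*n/2⌋≡n zero    = refl
  ⌊2*n/2⌋≡n (suc n) = trans (cong ⌊_/2⌋ (*-distribˡ-+ 2 1 n)) (cong suc (⌊2*n/2⌋≡n n))

module Forests where

  open import Data.Nat.Base using (_+_)
  open import Data.Nat.Properties using (suc-injective; +-identityʳ)
  import Data.List.Relation.Unary.All.Properties as All
  open import Data.List.Relation.Unary.Any using (here; there)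
  open import Data.List.Relation.Unary.AllPairs using ([]; _∷_)
  open import Data.List.Membership.Propositional.Properties using (∈-map⁺; ∈-map⁻; ∈-concat⁺)
  open import Data.List.Membership.Propositional.Properties.WithK using (unique∧set⇒bag)
  import Data.List.Relation.Unary.Unique.Propositional.Properties as Unique
  open import Data.List.Relation.Binary.Disjoint.Propositional using (Disjoint)
  open import Data.List.Relation.Binary.BagAndSetEquality using (∼bag⇒↭)
  open import Data.List.Properties using (∷-injective)
  open import Data.Maybe.Base using (Maybe; just; nothing)
  open import Data.Maybe.Properties using (just-injective)
  open import Data.Product.Base using (_,_; proj₁; proj₂)
  open import Function.Bundles using (mk⇔)
  open import Relation.Binary.PropositionalEquality using (_≢_; refl; sym; trans; cong)

  leaf : PlaneTree
  leaf = node []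

  data NonLeaf : PlaneTree → Set where
    node∷ : ∀ {c cs} → NonLeaf (node (c ∷ cs))

  record IsForest (n s : ℕ) (f : List PlaneTree) : Set where
    constructor forest
    field
      length≡ : length f ≡ s
      nonLeaves : All NonLeaf f
      edges≡ : edgesL f ≡ n

  consStick : List PlaneTree → List PlaneTree
  consStick f = node (leaf ∷ []) ∷ f

  plantFirst : List PlaneTree → List PlaneTree
  plantFirst []      = []
  plantFirst (t ∷ f) = node (t ∷ []) ∷ f

  addYoungLeaf : List PlaneTree → List PlaneTree
  addYoungLeaf (node (c ∷ cs) ∷ f) = node (c ∷ leaf ∷ cs) ∷ f
  addYoungLeaf f                   = f

  graftSecond : List PlaneTree → List PlaneTree
  graftSecond (node (c ∷ cs) ∷ d ∷ f) = node (c ∷ d ∷ cs) ∷ f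
  graftSecond f                       = f

  mutual
    forests : ℕ → ℕ → List (List PlaneTree)
    forests zero    zero    = [] ∷ []
    forests zero    (suc s) = []
    forests (suc n) zero    = []
    forests (suc n) (suc s) = concat (forestsByMove n s)

    forestsByMove : ℕ → ℕ → List (List (List PlaneTree))
    forestsByMove n s =
      map consStick (forests n s) ∷ map plantFirst (forests n (suc s)) ∷
      map addYoungLeaf (forests n (suc s)) ∷ map graftSecond (forests n (2 + s)) ∷ []

  edgesL-plant : ∀ c f → edgesL (node (c ∷ []) ∷ f) ≡ suc (edgesL (c ∷ f))
  edgesL-plant c f = cong (λ e → suc (e + edgesL f)) (+-identityʳ (edges c))

  edgesL-graft : ∀ c d cs f → edgesL (node (c ∷ d ∷ cs) ∷ f) ≡ suc (edgesL (node (c ∷ cs) ∷ d ∷ f))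
  edgesL-graft c d cs f = rearrange (length cs) (edges c) (edges d) (edgesL cs) (edgesL f)
    where
      rearrange : ∀ l x y z w → suc (suc l) + (x + (y + z)) + w ≡ suc (suc (l + (x + z)) + (y + w))
      rearrange = solve-∀

  consStick-forest : ∀ {n s f} → IsForest n s f → IsForest (suc n) (suc s) (consStick f)
  consStick-forest (forest l a e) = forest (cong suc l) (node∷ ∷ a) (cong suc e)

  plantFirst-forest : ∀ {n s f} → IsForest n (suc s) f → IsForest (suc n) (suc s) (plantFirst f)
  plantFirst-forest {f = c ∷ f} (forest l (_ ∷ a) e) = forest l (node∷ ∷ a) (trans (edgesL-plant c f) (cong suc e))

  addYoungLeaf-forest : ∀ {n s f} → IsForest n (suc s) f → IsForest (suc n) (suc s) (addYoungLeaf f)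
  addYoungLeaf-forest {f = node (_ ∷ _) ∷ _} (forest l (node∷ ∷ a) e) = forest l (node∷ ∷ a) (cong suc e)

  graftSecond-forest : ∀ {n s f} → IsForest n (2 + s) f → IsForest (suc n) (suc s) (graftSecond f)
  graftSecond-forest {f = node (c ∷ cs) ∷ d ∷ f} (forest l (node∷ ∷ _ ∷ a) e) =
    forest (suc-injective l) (node∷ ∷ a) (trans (edgesL-graft c d cs f) (cong suc e))

  forests-sound : ∀ n s → All (IsForest n s) (forests n s)
  forests-sound zero    zero    = forest refl [] refl ∷ []
  forests-sound zero    (suc s) = []
  forests-sound (suc n) zero    = []
  forests-sound (suc n) (suc s) = All.concat⁺
    ( All.map⁺ (All.map consStick-forest (forests-sound n s))
    ∷ All.map⁺ (All.map plantFirst-forest (forests-sound n (suc s)))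
    ∷ All.map⁺ (All.map addYoungLeaf-forest (forests-sound n (suc s)))
    ∷ All.map⁺ (All.map graftSecond-forest (forests-sound n (2 + s)))
    ∷ [])

  forests-complete : ∀ {n s f} → IsForest n s f → f ∈ forests n s
  forests-complete {zero}  {zero}  {[]}                 _                    = here refl
  forests-complete {zero}  {suc s} {[]}                 (forest () _ _)
  forests-complete {suc n} {_}     {[]}                 (forest _ _ ())
  forests-complete {_}     {_}     {node [] ∷ _}        (forest _ (() ∷ _) _)
  forests-complete {zero}  {_}     {node (_ ∷ _) ∷ _}   (forest _ _ ())
  forests-complete {suc n} {zero}  {_ ∷ _}              (forest () _ _)
  forests-complete {suc n} {suc s} {node (node [] ∷ []) ∷ f} (forest l (_ ∷ a) e) =
    ∈-concat⁺ {xss = forestsByMove n s} (here (∈-map⁺ consStick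
      (forests-complete (forest (suc-injective l) a (suc-injective e)))))
  forests-complete {suc n} {suc s} {node (c@(node (_ ∷ _)) ∷ []) ∷ f} (forest l (_ ∷ a) e) =
    ∈-concat⁺ {xss = forestsByMove n s} (there (here (∈-map⁺ plantFirst
      (forests-complete (forest l (node∷ ∷ a) (suc-injective (trans (sym (edgesL-plant c f)) e)))))))
  forests-complete {suc n} {suc s} {node (c ∷ node [] ∷ cs) ∷ f} (forest l (_ ∷ a) e) =
    ∈-concat⁺ {xss = forestsByMove n s} (there (there (here (∈-map⁺ addYoungLeaf
      (forests-complete (forest l (node∷ ∷ a) (suc-injective e)))))))
  forests-complete {suc n} {suc s} {node (c ∷ d@(node (_ ∷ _)) ∷ cs) ∷ f} (forest l (_ ∷ a) e) =
    ∈-concat⁺ {xss = forestsByMove n s} (there (there (there (here (∈-map⁺ graftSecond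
      (forests-complete (forest (cong suc l) (node∷ ∷ node∷ ∷ a)
                                (suc-injective (trans (sym (edgesL-graft c d cs f)) e)))))))))

  data Move : Set where
    stick plant youngLeaf graft : Move

  lastMove : List PlaneTree → Maybe Move
  lastMove (node (_ ∷ node [] ∷ _) ∷ _)      = just youngLeaf
  lastMove (node (_ ∷ node (_ ∷ _) ∷ _) ∷ _) = just graft
  lastMove (node (node [] ∷ []) ∷ _)         = just stick
  lastMove (node (node (_ ∷ _) ∷ []) ∷ _)    = just plant
  lastMove _                                 = nothing

  lastMove-plantFirst : ∀ {n s f} → IsForest n (suc s) f → lastMove (plantFirst f) ≡ just plant
  lastMove-plantFirst {f = node (_ ∷ _) ∷ _} (forest _ (node∷ ∷ _) _) = refl

  lastMove-addYoungLeaf : ∀ {n s f} → IsForest n (suc s) f → lastMove (addYoungLeaf f) ≡ just youngLeaf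
  lastMove-addYoungLeaf {f = node (_ ∷ _) ∷ _} (forest _ (node∷ ∷ _) _) = refl

  lastMove-graftSecond : ∀ {n s f} → IsForest n (2 + s) f → lastMove (graftSecond f) ≡ just graft
  lastMove-graftSecond {f = node (_ ∷ _) ∷ node (_ ∷ _) ∷ _} (forest _ (node∷ ∷ node∷ ∷ _) _) = refl

  plantFirst-injective : ∀ {n s f g} → IsForest n (suc s) f → IsForest n (suc s) g →
                         plantFirst f ≡ plantFirst g → f ≡ g
  plantFirst-injective {f = _ ∷ _} {g = _ ∷ _} _ _ refl = refl

  addYoungLeaf-injective : ∀ {n s f g} → IsForest n (suc s) f → IsForest n (suc s) g →
                           addYoungLeaf f ≡ addYoungLeaf g → f ≡ g
  addYoungLeaf-injective {f = node (_ ∷ _) ∷ _} {g = node (_ ∷ _) ∷ _}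
    (forest _ (node∷ ∷ _) _) (forest _ (node∷ ∷ _) _) refl = refl

  graftSecond-injective : ∀ {n s f g} → IsForest n (2 + s) f → IsForest n (2 + s) g →
                          graftSecond f ≡ graftSecond g → f ≡ g
  graftSecond-injective {f = node (_ ∷ _) ∷ _ ∷ _} {g = node (_ ∷ _) ∷ _ ∷ _}
    (forest _ (node∷ ∷ node∷ ∷ _) _) (forest _ (node∷ ∷ node∷ ∷ _) _) refl = refl

  module _ {A B : Set} {P : A → Set} {h : A → B} (h-injective : ∀ {x y} → P x → P y → h x ≡ h y → x ≡ y) where

    Unique-map⁺-onAll : ∀ {xs} → All P xs → Unique xs → Unique (map h xs)
    Unique-map⁺-onAll []         []           = []
    Unique-map⁺-onAll (px ∷ pxs) (x∉xs ∷ uxs) =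
      All.map⁺ (All.zipWith (λ (py , x≢y) hx≡hy → x≢y (h-injective px py hx≡hy)) (pxs , x∉xs))
        ∷ Unique-map⁺-onAll pxs uxs

  Disjoint-byLastMove : ∀ {xs ys m m′} → All (λ f → lastMove f ≡ just m) xs → All (λ f → lastMove f ≡ just m′) ys →
                        m ≢ m′ → Disjoint xs ys
  Disjoint-byLastMove xs-m ys-m′ m≢m′ (f∈xs , f∈ys) =
    m≢m′ (just-injective (trans (sym (All.lookup xs-m f∈xs)) (All.lookup ys-m′ f∈ys)))

  forests-unique : ∀ n s → Unique (forests n s)
  forests-unique zero    zero    = [] ∷ []
  forests-unique zero    (suc s) = []
  forests-unique (suc n) zero    = []
  forests-unique (suc n) (suc s) = Unique.concat⁺
    ( Unique.map⁺ (λ eq → proj₂ (∷-injective eq)) (forests-unique n s)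
    ∷ Unique-map⁺-onAll plantFirst-injective (forests-sound n (suc s)) (forests-unique n (suc s))
    ∷ Unique-map⁺-onAll addYoungLeaf-injective (forests-sound n (suc s)) (forests-unique n (suc s))
    ∷ Unique-map⁺-onAll graftSecond-injective (forests-sound n (2 + s)) (forests-unique n (2 + s))
    ∷ [])
    ( (Disjoint-byLastMove sticks plants (λ ()) ∷ Disjoint-byLastMove sticks youngLeaves (λ ())
        ∷ Disjoint-byLastMove sticks grafts (λ ()) ∷ [])
    ∷ (Disjoint-byLastMove plants youngLeaves (λ ()) ∷ Disjoint-byLastMove plants grafts (λ ()) ∷ [])
    ∷ (Disjoint-byLastMove youngLeaves grafts (λ ()) ∷ [])
    ∷ [] ∷ [])
    where
      sticks : All (λ f → lastMove f ≡ just stick) (map consStick (forests n s))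
      sticks = All.map⁺ (All.universal (λ _ → refl) (forests n s))
      plants : All (λ f → lastMove f ≡ just plant) (map plantFirst (forests n (suc s)))
      plants = All.map⁺ (All.map lastMove-plantFirst (forests-sound n (suc s)))
      youngLeaves : All (λ f → lastMove f ≡ just youngLeaf) (map addYoungLeaf (forests n (suc s)))
      youngLeaves = All.map⁺ (All.map lastMove-addYoungLeaf (forests-sound n (suc s)))
      grafts : All (λ f → lastMove f ≡ just graft) (map graftSecond (forests n (2 + s)))
      grafts = All.map⁺ (All.map lastMove-graftSecond (forests-sound n (2 + s)))

  singletons↭forests : ∀ {n Ps} → (∀ {T} → T ∈ Ps → edges T ≡ suc n) → (∀ {T} → edges T ≡ suc n → T ∈ Ps) →
                       Unique Ps → map [_] Ps ↭ forests (suc n) 1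
  singletons↭forests {n} {Ps} ∈⇒edges edges⇒∈ Ps-unique = ∼bag⇒↭ (unique∧set⇒bag
    (Unique.map⁺ (λ eq → proj₁ (∷-injective eq)) Ps-unique) (forests-unique (suc n) 1) (mk⇔ to from))
    where
      nonLeaf : ∀ {T} → edges T ≡ suc n → NonLeaf T
      nonLeaf {node (_ ∷ _)} _ = node∷
      to : ∀ {f} → f ∈ map [_] Ps → f ∈ forests (suc n) 1
      to f∈ with T , T∈Ps , refl ← ∈-map⁻ [_] f∈ =
        forests-complete (forest refl (nonLeaf (∈⇒edges T∈Ps) ∷ []) (trans (+-identityʳ (edges T)) (∈⇒edges T∈Ps)))
      from : ∀ {f} → f ∈ forests (suc n) 1 → f ∈ map [_] Ps
      from f∈ with All.lookup (forests-sound (suc n) 1) f∈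
      from {[]}        _ | forest () _ _
      from {T ∷ []}    _ | forest _ _ e = ∈-map⁺ [_] (edges⇒∈ (trans (sym (+-identityʳ (edges T))) e))
      from {_ ∷ _ ∷ _} _ | forest () _ _

module SemiringSums {c ℓ : Level} (R : CommutativeSemiring c ℓ) where

  open CommutativeSemiring R renaming (Carrier to A)
  open Poly R using (sumUpTo; sumList)
  open import Data.List.Base using (_++_; foldr)
  open import Data.Nat.Base using (_≤_; z≤n; s≤s)
  open import Data.Nat.Combinatorics using (nCk+nC[k+1]≡[n+1]C[k+1]; k>n⇒nCk≡0)
  open import Data.Nat.DivMod using (m≡m%n+[m/n]*n; m%n<n)
  open import Data.List.Relation.Binary.Permutation.Propositional using (↭⇒↭ₛ′)
  import Data.List.Relation.Binary.Permutation.Propositional.Properties as ↭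
  import Data.List.Relation.Binary.Permutation.Setoid.Properties as PermutationProperties
  open import Algebra.Definitions.RawSemiring rawSemiring using (_×_; _^_)
  open import Algebra.Properties.Semiring.Mult semiring using (×-congʳ; ×-homo-+; ×-comm-*)
  open import Algebra.Properties.CommutativeMonoid.Mult +-commutativeMonoid using (×-distrib-+)
  open import Algebra.Solver.Ring.NaturalCoefficients.Default R using (solve; _:+_; _:*_; _:=_)
  open import Relation.Binary.Reasoning.Setoid setoid

  sumUpTo-cong : ∀ {f g} m → (∀ i → i ≤ m → f i ≈ g i) → sumUpTo f m ≈ sumUpTo g m
  sumUpTo-cong zero    f≈g = f≈g 0 z≤n
  sumUpTo-cong (suc m) f≈g =
    +-cong (sumUpTo-cong m (λ i i≤m → f≈g i (ℕ.m≤n⇒m≤1+n i≤m))) (f≈g (suc m) ℕ.≤-refl)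

  sumUpTo-+ : ∀ f g m → sumUpTo (λ i → f i + g i) m ≈ sumUpTo f m + sumUpTo g m
  sumUpTo-+ f g zero    = refl
  sumUpTo-+ f g (suc m) = trans (+-congʳ (sumUpTo-+ f g m))
    (solve 4 (λ a b c d → (a :+ b) :+ (c :+ d) := (a :+ c) :+ (b :+ d)) refl
             (sumUpTo f m) (sumUpTo g m) (f (suc m)) (g (suc m)))

  *-distribˡ-sumUpTo : ∀ a f m → a * sumUpTo f m ≈ sumUpTo (λ i → a * f i) m
  *-distribˡ-sumUpTo a f zero    = refl
  *-distribˡ-sumUpTo a f (suc m) = trans (distribˡ a _ _) (+-congʳ (*-distribˡ-sumUpTo a f m))

  sumUpTo-unfoldˡ : ∀ f m → sumUpTo f (suc m) ≈ f 0 + sumUpTo (f ∘ suc) m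
  sumUpTo-unfoldˡ f zero    = refl
  sumUpTo-unfoldˡ f (suc m) = trans (+-congʳ (sumUpTo-unfoldˡ f m)) (+-assoc _ _ _)

  module _ (f : ℕ → A) (f-odd≈0 : ∀ k → f (suc (2 ℕ.* k)) ≈ 0#) where

    private
      sumUpTo-double : ∀ k → sumUpTo f (2 ℕ.* k) ≈ sumUpTo (f ∘ (2 ℕ.*_)) k
      sumUpTo-double+1 : ∀ k → sumUpTo f (suc (2 ℕ.* k)) ≈ sumUpTo (f ∘ (2 ℕ.*_)) k

      sumUpTo-double zero    = refl
      sumUpTo-double (suc k) = begin
        sumUpTo f (2 ℕ.* suc k)                        ≡⟨ ≡.cong (sumUpTo f) 2[1+k]≡2+2k ⟩
        sumUpTo f (suc (2 ℕ.* k)) + f (2 ℕ.+ 2 ℕ.* k)  ≈⟨ +-congʳ (sumUpTo-double+1 k) ⟩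
        sumUpTo (f ∘ (2 ℕ.*_)) k + f (2 ℕ.+ 2 ℕ.* k)   ≡⟨ ≡.cong (λ i → evens + f i) 2[1+k]≡2+2k ⟨
        sumUpTo (f ∘ (2 ℕ.*_)) (suc k)                 ∎
        where
          evens : A
          evens = sumUpTo (f ∘ (2 ℕ.*_)) k
          2[1+k]≡2+2k : 2 ℕ.* suc k ≡ 2 ℕ.+ 2 ℕ.* k
          2[1+k]≡2+2k = ℕ.*-distribˡ-+ 2 1 k
      sumUpTo-double+1 k = trans (+-cong (sumUpTo-double k) (f-odd≈0 k)) (+-identityʳ _)

    sumUpTo-evens : ∀ m → sumUpTo f m ≈ sumUpTo (f ∘ (2 ℕ.*_)) (m ℕ./ 2)
    sumUpTo-evens m with m ℕ.% 2 | m%n<n m 2 | m≡m%n+[m/n]*n m 2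
    ... | 0 | _ | m≡ = trans (reflexive (≡.cong (sumUpTo f) (≡.trans m≡ (ℕ.*-comm (m ℕ./ 2) 2))))
                             (sumUpTo-double (m ℕ./ 2))
    ... | 1 | _ | m≡ = trans (reflexive (≡.cong (sumUpTo f) (≡.trans m≡ (≡.cong suc (ℕ.*-comm (m ℕ./ 2) 2)))))
                             (sumUpTo-double+1 (m ℕ./ 2))
    ... | suc (suc _) | s≤s (s≤s ()) | _

  binomialConv : (ℕ → A) → (ℕ → A) → ℕ → A
  binomialConv f g n = sumUpTo (λ i → (n C i) × (f i * g (n ∸ i))) n

  binomialConv-zero : ∀ f g → binomialConv f g 0 ≈ f 0 * g 0
  binomialConv-zero f g = +-identityʳ _

  binomialConv-suc : ∀ f g n →
    binomialConv f g (suc n) ≈ binomialConv f (g ∘ suc) n + binomialConv (f ∘ suc) g n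
  binomialConv-suc f g n = begin
    binomialConv f g (suc n)                                ≈⟨ sumUpTo-unfoldˡ _ n ⟩
    term 0 + sumUpTo (λ i → (suc n C suc i) × (f (suc i) * g (n ∸ i))) n
                                                            ≈⟨ +-congˡ (sumUpTo-cong n (λ i _ → pascal i)) ⟩
    term 0 + sumUpTo (λ i → lower i + upper i) n            ≈⟨ +-congˡ (sumUpTo-+ lower upper n) ⟩
    term 0 + (sumUpTo lower n + sumUpTo upper n)            ≈⟨ solve 3 (λ a b c → a :+ (b :+ c) := (a :+ c) :+ b) refl
                                                                       (term 0) (sumUpTo lower n) (sumUpTo upper n) ⟩
    (term 0 + sumUpTo upper n) + sumUpTo lower n            ≈⟨ +-congʳ (sumUpTo-unfoldˡ term n) ⟨
    sumUpTo term (suc n) + sumUpTo lower n                  ≈⟨ +-congʳ drop-last ⟩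
    binomialConv f (g ∘ suc) n + binomialConv (f ∘ suc) g n ∎
    where
      term lower upper : ℕ → A
      term i  = (n C i) × (f i * g (suc n ∸ i))
      lower i = (n C i) × (f (suc i) * g (n ∸ i))
      upper i = (n C suc i) × (f (suc i) * g (n ∸ i))
      pascal : ∀ i → (suc n C suc i) × (f (suc i) * g (n ∸ i)) ≈ lower i + upper i
      pascal i = trans (reflexive (≡.cong (_× (f (suc i) * g (n ∸ i))) (≡.sym (nCk+nC[k+1]≡[n+1]C[k+1] n i))))
                       (×-homo-+ _ (n C i) (n C suc i))
      drop-last : sumUpTo term (suc n) ≈ binomialConv f (g ∘ suc) n
      drop-last = trans
        (+-cong (sumUpTo-cong n (λ i i≤n → reflexive (≡.cong (λ k → (n C i) × (f i * g k)) (ℕ.+-∸-assoc 1 i≤n))))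
                (reflexive (≡.cong (_× (f (suc n) * g (n ∸ n))) (k>n⇒nCk≡0 (ℕ.n<1+n n)))))
        (+-identityʳ _)

  binomialConv-comm : ∀ f g n → binomialConv f g n ≈ binomialConv g f n
  binomialConv-comm f g zero    = ×-congʳ 1 (*-comm (f 0) (g 0))
  binomialConv-comm f g (suc n) = begin
    binomialConv f g (suc n)                                 ≈⟨ binomialConv-suc f g n ⟩
    binomialConv f (g ∘ suc) n + binomialConv (f ∘ suc) g n  ≈⟨ +-cong (binomialConv-comm f (g ∘ suc) n)
                                                                       (binomialConv-comm (f ∘ suc) g n) ⟩
    binomialConv (g ∘ suc) f n + binomialConv g (f ∘ suc) n  ≈⟨ +-comm _ _ ⟩
    binomialConv g (f ∘ suc) n + binomialConv (g ∘ suc) f n  ≈⟨ binomialConv-suc g f n ⟨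
    binomialConv g f (suc n)                                 ∎

  binomialConv-congˡ : ∀ {f f′} g n → (∀ i → f i ≈ f′ i) → binomialConv f g n ≈ binomialConv f′ g n
  binomialConv-congˡ g n f≈f′ = sumUpTo-cong n (λ i _ → ×-congʳ (n C i) (*-congʳ (f≈f′ i)))

  binomialConv-+ˡ : ∀ f f′ g n →
    binomialConv (λ i → f i + f′ i) g n ≈ binomialConv f g n + binomialConv f′ g n
  binomialConv-+ˡ f f′ g n = trans
    (sumUpTo-cong n (λ i _ → trans (×-congʳ (n C i) (distribʳ (g (n ∸ i)) (f i) (f′ i))) (×-distrib-+ _ _ (n C i))))
    (sumUpTo-+ _ _ n)

  binomialConv-*ˡ : ∀ a f g n → binomialConv (λ i → a * f i) g n ≈ a * binomialConv f g n
  binomialConv-*ˡ a f g n = trans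
    (sumUpTo-cong n (λ i _ → trans (×-congʳ (n C i) (*-assoc _ _ _)) (sym (×-comm-* (n C i) a _))))
    (sym (*-distribˡ-sumUpTo a _ n))

  binomialConv-*ʳ : ∀ a f g n → binomialConv f (λ i → a * g i) n ≈ a * binomialConv f g n
  binomialConv-*ʳ a f g n =
    trans (binomialConv-comm f _ n) (trans (binomialConv-*ˡ a g f n) (*-congˡ (binomialConv-comm g f n)))

  sumList≡foldr : ∀ {B : Set} (f : B → A) xs → sumList f xs ≡ foldr _+_ 0# (map f xs)
  sumList≡foldr f []       = ≡.refl
  sumList≡foldr f (x ∷ xs) = ≡.cong (f x +_) (sumList≡foldr f xs)

  sumList-↭ : ∀ {B : Set} (f : B → A) {xs ys} → xs ↭ ys → sumList f xs ≈ sumList f ys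
  sumList-↭ f {xs} {ys} xs↭ys = begin
    sumList f xs             ≡⟨ sumList≡foldr f xs ⟩
    foldr _+_ 0# (map f xs)  ≈⟨ foldr-commMonoid +-isCommutativeMonoid (↭⇒↭ₛ′ isEquivalence (↭.map⁺ f xs↭ys)) ⟩
    foldr _+_ 0# (map f ys)  ≡⟨ sumList≡foldr f ys ⟨
    sumList f ys             ∎
    where open PermutationProperties setoid using (foldr-commMonoid)

  sumList-++ : ∀ {B : Set} (f : B → A) xs ys → sumList f (xs ++ ys) ≈ sumList f xs + sumList f ys
  sumList-++ f []       ys = sym (+-identityˡ _)
  sumList-++ f (x ∷ xs) ys = trans (+-congˡ (sumList-++ f xs ys)) (sym (+-assoc _ _ _))

  sumList-concat : ∀ {B : Set} (f : B → A) xss → sumList f (concat xss) ≈ sumList (sumList f) xss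
  sumList-concat f []         = refl
  sumList-concat f (xs ∷ xss) = trans (sumList-++ f xs (concat xss)) (+-congˡ (sumList-concat f xss))

  sumList-map : ∀ {B C : Set} {f : B → A} {g : C → A} {h : C → B} {xs} →
                All (λ x → f (h x) ≈ g x) xs → sumList f (map h xs) ≈ sumList g xs
  sumList-map []           = refl
  sumList-map (fhx≈gx ∷ p) = +-cong fhx≈gx (sumList-map p)

  *-distribˡ-sumList : ∀ {B : Set} a (f : B → A) xs → a * sumList f xs ≈ sumList (λ x → a * f x) xs
  *-distribˡ-sumList a f []       = zeroʳ a
  *-distribˡ-sumList a f (x ∷ xs) = trans (distribˡ a _ _) (+-congˡ (*-distribˡ-sumList a f xs))

module MotzkinPaths {c ℓ : Level} (R : CommutativeSemiring c ℓ) (u : CommutativeSemiring.Carrier R) where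

  open CommutativeSemiring R renaming (Carrier to A)
  open Poly R using (sumUpTo; motzkin)
  open SemiringSums R
  open BallotNumbers using (ballot; ballot-odd; ballot≡catalan; ⌊2*n/2⌋≡n)
  open import Algebra.Definitions.RawSemiring rawSemiring using (_×_; _^_)
  open import Algebra.Properties.Semiring.Mult semiring using (×-congʳ; ×-homo-+; ×-comm-*; ×-assoc-*)
  open import Algebra.Solver.Ring.NaturalCoefficients.Default R using (solve; _:+_; _:*_; _:=_)
  open import Relation.Binary.Reasoning.Setoid setoid

  -- motzkinPaths v n h is the weighted count of Motzkin paths of length n from height h to height 0
  -- that never go below 0, with weight u per down-step, v per level step and 1 per up-step.
  motzkinPaths : A → ℕ → ℕ → A
  motzkinPaths v zero    zero    = 1#
  motzkinPaths v zero    (suc h) = 0#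
  motzkinPaths v (suc n) zero    = v * motzkinPaths v n 0 + motzkinPaths v n 1
  motzkinPaths v (suc n) (suc h) =
    u * motzkinPaths v n h + (v * motzkinPaths v n (suc h) + motzkinPaths v n (2 ℕ.+ h))

  motzkinPaths-split : ∀ {a b v} → a + b ≈ v → ∀ n h →
    motzkinPaths v n h ≈ binomialConv (λ m → motzkinPaths a m h) (b ^_) n
  motzkinPaths-split {a} {b} {v} a+b≈v = split
    where
      T : ℕ → ℕ → A
      T n h = binomialConv (λ m → motzkinPaths a m h) (b ^_) n

      T-suc : ∀ n h → T (suc n) h ≈ binomialConv (λ m → motzkinPaths a (suc m) h) (b ^_) n + b * T n h
      T-suc n h = trans (binomialConv-suc (λ m → motzkinPaths a m h) (b ^_) n)
                        (trans (+-congʳ (binomialConv-*ʳ b (λ m → motzkinPaths a m h) (b ^_) n)) (+-comm _ _))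

      split : ∀ n h → motzkinPaths v n h ≈ T n h
      split zero zero    = sym (trans (binomialConv-zero (λ m → motzkinPaths a m 0) (b ^_)) (*-identityʳ 1#))
      split zero (suc h) = sym (trans (binomialConv-zero (λ m → motzkinPaths a m (suc h)) (b ^_)) (zeroˡ 1#))
      split (suc n) zero = begin
        v * motzkinPaths v n 0 + motzkinPaths v n 1
          ≈⟨ +-cong (*-cong (sym a+b≈v) (split n 0)) (split n 1) ⟩
        (a + b) * T n 0 + T n 1
          ≈⟨ solve 4 (λ a b t₀ t₁ → (a :+ b) :* t₀ :+ t₁ := (a :* t₀ :+ t₁) :+ b :* t₀) refl a b (T n 0) (T n 1) ⟩
        (a * T n 0 + T n 1) + b * T n 0
          ≈⟨ +-congʳ (trans (binomialConv-+ˡ _ _ (b ^_) n) (+-congʳ (binomialConv-*ˡ a _ (b ^_) n))) ⟨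
        binomialConv (λ m → motzkinPaths a (suc m) 0) (b ^_) n + b * T n 0
          ≈⟨ T-suc n 0 ⟨
        T (suc n) 0 ∎
      split (suc n) (suc h) = begin
        u * motzkinPaths v n h + (v * motzkinPaths v n (suc h) + motzkinPaths v n (2 ℕ.+ h))
          ≈⟨ +-cong (*-congˡ (split n h)) (+-cong (*-cong (sym a+b≈v) (split n (suc h))) (split n (2 ℕ.+ h))) ⟩
        u * T n h + ((a + b) * T n (suc h) + T n (2 ℕ.+ h))
          ≈⟨ solve 6 (λ u a b t₀ t₁ t₂ → u :* t₀ :+ ((a :+ b) :* t₁ :+ t₂)
                                      := (u :* t₀ :+ (a :* t₁ :+ t₂)) :+ b :* t₁)
                   refl u a b (T n h) (T n (suc h)) (T n (2 ℕ.+ h)) ⟩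
        (u * T n h + (a * T n (suc h) + T n (2 ℕ.+ h))) + b * T n (suc h)
          ≈⟨ +-congʳ (trans (binomialConv-+ˡ _ _ (b ^_) n)
                            (+-cong (binomialConv-*ˡ u _ (b ^_) n)
                                    (trans (binomialConv-+ˡ _ _ (b ^_) n) (+-congʳ (binomialConv-*ˡ a _ (b ^_) n))))) ⟨
        binomialConv (λ m → motzkinPaths a (suc m) (suc h)) (b ^_) n + b * T n (suc h)
          ≈⟨ T-suc n (suc h) ⟨
        T (suc n) (suc h) ∎

  motzkinPaths-dyck : ∀ j h → motzkinPaths 0# j h ≈ ballot j h × u ^ ⌊ j ℕ.+ h /2⌋
  motzkinPaths-dyck zero    zero    = sym (+-identityʳ 1#)
  motzkinPaths-dyck zero    (suc h) = refl
  motzkinPaths-dyck (suc j) zero    = begin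
    0# * motzkinPaths 0# j 0 + motzkinPaths 0# j 1  ≈⟨ trans (+-congʳ (zeroˡ _)) (+-identityˡ _) ⟩
    motzkinPaths 0# j 1                            ≈⟨ motzkinPaths-dyck j 1 ⟩
    ballot j 1 × u ^ ⌊ j ℕ.+ 1 /2⌋                 ≡⟨ ≡.cong (λ i → ballot j 1 × u ^ ⌊ i /2⌋) (ℕ.+-suc j 0) ⟩
    ballot j 1 × u ^ ⌊ suc j ℕ.+ 0 /2⌋             ∎
  motzkinPaths-dyck (suc j) (suc h) = begin
    u * motzkinPaths 0# j h + (0# * motzkinPaths 0# j (suc h) + motzkinPaths 0# j (2 ℕ.+ h))
      ≈⟨ +-cong (*-congˡ (motzkinPaths-dyck j h))
                (trans (+-congʳ (zeroˡ _)) (trans (+-identityˡ _) (motzkinPaths-dyck j (2 ℕ.+ h)))) ⟩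
    u * (ballot j h × u ^ e) + ballot j (2 ℕ.+ h) × u ^ ⌊ j ℕ.+ (2 ℕ.+ h) /2⌋
      ≈⟨ +-cong (×-comm-* (ballot j h) u _)
                (reflexive (≡.cong (λ i → ballot j (2 ℕ.+ h) × u ^ i) ⌊j+2+h/2⌋≡1+e)) ⟩
    ballot j h × u ^ suc e + ballot j (2 ℕ.+ h) × u ^ suc e
      ≈⟨ ×-homo-+ _ (ballot j h) (ballot j (2 ℕ.+ h)) ⟨
    (ballot j h ℕ.+ ballot j (2 ℕ.+ h)) × u ^ suc e
      ≡⟨ ≡.cong (λ i → (ballot j h ℕ.+ ballot j (2 ℕ.+ h)) × u ^ ⌊ suc i /2⌋) (ℕ.+-suc j h) ⟨
    (ballot j h ℕ.+ ballot j (2 ℕ.+ h)) × u ^ ⌊ suc j ℕ.+ suc h /2⌋ ∎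
    where
      e : ℕ
      e = ⌊ j ℕ.+ h /2⌋
      ⌊j+2+h/2⌋≡1+e : ⌊ j ℕ.+ (2 ℕ.+ h) /2⌋ ≡ suc e
      ⌊j+2+h/2⌋≡1+e = ≡.cong ⌊_/2⌋ (≡.trans (ℕ.+-suc j (suc h)) (≡.cong suc (ℕ.+-suc j h)))

  u*motzkinPaths≈motzkin : ∀ v m → u * motzkinPaths v m 0 ≈ motzkin m u v
  u*motzkinPaths≈motzkin v m = begin
    u * motzkinPaths v m 0
      ≈⟨ *-congˡ (motzkinPaths-split (+-identityˡ v) m 0) ⟩
    u * binomialConv (λ j → motzkinPaths 0# j 0) (v ^_) m
      ≈⟨ *-congˡ (binomialConv-congˡ (v ^_) m (λ j → motzkinPaths-dyck j 0)) ⟩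
    u * sumUpTo term m
      ≈⟨ *-congˡ (sumUpTo-evens term term-odd≈0 m) ⟩
    u * sumUpTo (term ∘ (2 ℕ.*_)) (m ℕ./ 2)
      ≈⟨ *-distribˡ-sumUpTo u _ (m ℕ./ 2) ⟩
    sumUpTo (λ k → u * term (2 ℕ.* k)) (m ℕ./ 2)
      ≈⟨ sumUpTo-cong (m ℕ./ 2) (λ k _ → u*term-even k) ⟩
    motzkin m u v ∎
    where
      term : ℕ → A
      term j = (m C j) × ((ballot j 0 × u ^ ⌊ j ℕ.+ 0 /2⌋) * v ^ (m ∸ j))

      term-odd≈0 : ∀ k → term (suc (2 ℕ.* k)) ≈ 0#
      term-odd≈0 k = begin
        (m C j) × ((ballot j 0 × p) * w)  ≡⟨ ≡.cong (λ b → (m C j) × ((b × p) * w)) ballot≡0 ⟩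
        (m C j) × (0# * w)                ≈⟨ ×-comm-* (m C j) 0# w ⟨
        0# * ((m C j) × w)                ≈⟨ zeroˡ _ ⟩
        0#                                ∎
        where
          j : ℕ
          j = suc (2 ℕ.* k)
          p w : A
          p = u ^ ⌊ j ℕ.+ 0 /2⌋
          w = v ^ (m ∸ j)
          ballot≡0 : ballot j 0 ≡ 0
          ballot≡0 = ballot-odd j 0 k
            (≡.cong suc (≡.trans (ℕ.+-identityʳ (2 ℕ.* k)) (≡.cong (k ℕ.+_) (ℕ.+-identityʳ k))))

      ×-as-* : ∀ n x → n × x ≈ (n × 1#) * x
      ×-as-* n x = sym (trans (×-assoc-* n 1# x) (×-congʳ n (*-identityˡ x)))

      u*term-even : ∀ k →
        u * term (2 ℕ.* k) ≈ ((m C (2 ℕ.* k)) × (catalan k × 1#)) * ((u ^ suc k) * (v ^ (m ∸ 2 ℕ.* k)))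
      u*term-even k = begin
        u * ((m C (2 ℕ.* k)) × ((ballot (2 ℕ.* k) 0 × u ^ ⌊ 2 ℕ.* k ℕ.+ 0 /2⌋) * w))
          ≡⟨ ≡.cong₂ (λ b i → u * ((m C (2 ℕ.* k)) × ((b × u ^ i) * w))) (ballot≡catalan k)
                     (≡.trans (≡.cong ⌊_/2⌋ (ℕ.+-identityʳ (2 ℕ.* k))) (⌊2*n/2⌋≡n k)) ⟩
        u * ((m C (2 ℕ.* k)) × ((catalan k × u ^ k) * w))
          ≈⟨ *-congˡ (trans (×-as-* (m C (2 ℕ.* k)) _) (*-congˡ (*-congʳ (×-as-* (catalan k) (u ^ k))))) ⟩
        u * (N * ((Cₖ * u ^ k) * w))
          ≈⟨ solve 5 (λ u N c p w → u :* (N :* ((c :* p) :* w)) := (N :* c) :* ((u :* p) :* w)) refl u N Cₖ (u ^ k) w ⟩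
        (N * Cₖ) * ((u * u ^ k) * w)
          ≈⟨ *-congʳ (×-as-* (m C (2 ℕ.* k)) (catalan k × 1#)) ⟨
        ((m C (2 ℕ.* k)) × (catalan k × 1#)) * ((u ^ suc k) * w) ∎
        where
          w N Cₖ : A
          w  = v ^ (m ∸ 2 ℕ.* k)
          N  = (m C (2 ℕ.* k)) × 1#
          Cₖ = catalan k × 1#

module ForestWeights {c ℓ : Level} (R : CommutativeSemiring c ℓ) (x₁ x₂ y₁ y₂ : CommutativeSemiring.Carrier R) where

  open CommutativeSemiring R renaming (Carrier to A)
  open Poly R using (sumList; weight; G)
  open Forests
  open SemiringSums R
  open MotzkinPaths R (x₁ * y₁)
  open import Algebra.Definitions.RawSemiring rawSemiring using (_^_)
  open import Algebra.Properties.Semiring.Exp semiring using (^-homo-*)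
  open import Algebra.Solver.Ring.NaturalCoefficients.Default R using (solve; _:+_; _:*_; _:=_; con)
  open import Relation.Binary.Reasoning.Setoid setoid

  u : A
  u = x₁ * y₁

  wt : PlaneTree → A
  wt = weight x₁ x₂ y₁ y₂

  monomial : ℕ → ℕ → ℕ → ℕ → A
  monomial a b c d = ((x₁ ^ a * x₂ ^ b) * y₁ ^ c) * y₂ ^ d

  wt≈monomial : ∀ T {a b c d} → oleaf T ≡ a → yleaf T ≡ b → oint T ≡ c → yint T ≡ d → wt T ≈ monomial a b c d
  wt≈monomial T ≡.refl ≡.refl ≡.refl ≡.refl = refl

  monomial-+ : ∀ a b c d a′ b′ c′ d′ →
    monomial (a ℕ.+ a′) (b ℕ.+ b′) (c ℕ.+ c′) (d ℕ.+ d′) ≈ monomial a b c d * monomial a′ b′ c′ d′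
  monomial-+ a b c d a′ b′ c′ d′ = trans
    (*-cong (*-cong (*-cong (^-homo-* x₁ a a′) (^-homo-* x₂ b b′)) (^-homo-* y₁ c c′)) (^-homo-* y₂ d d′))
    (solve 8 (λ p p′ q q′ r r′ s s′ → (((p :* p′) :* (q :* q′)) :* (r :* r′)) :* (s :* s′)
                                       := (((p :* q) :* r) :* s) :* (((p′ :* q′) :* r′) :* s′))
             refl (x₁ ^ a) (x₁ ^ a′) (x₂ ^ b) (x₂ ^ b′) (y₁ ^ c) (y₁ ^ c′) (y₂ ^ d) (y₂ ^ d′))

  wt-stick : wt (node (leaf ∷ [])) ≈ u
  wt-stick = solve 2 (λ a b → (((a :* con 1) :* con 1) :* (b :* con 1)) :* con 1 := a :* b) refl x₁ y₁

  wt-plant : ∀ {c} → NonLeaf c → wt (node (c ∷ [])) ≈ y₂ * wt c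
  wt-plant {c} node∷ = trans
    (wt≈monomial (node (c ∷ []))
      (ℕ.+-identityʳ _) (ℕ.+-identityʳ _) (ℕ.+-identityʳ _) (≡.cong suc (ℕ.+-identityʳ _)))
    (solve 5 (λ p q r s y → ((p :* q) :* r) :* (y :* s) := y :* (((p :* q) :* r) :* s)) refl
             (x₁ ^ oleaf c) (x₂ ^ yleaf c) (y₁ ^ oint c) (y₂ ^ yint c) y₂)

  wt-addYoungLeaf : ∀ c cs → wt (node (c ∷ leaf ∷ cs)) ≈ x₂ * wt (node (c ∷ cs))
  wt-addYoungLeaf c cs =
    solve 5 (λ p q r s x → ((p :* (x :* q)) :* r) :* s := x :* (((p :* q) :* r) :* s)) refl
            (x₁ ^ oleaf T) (x₂ ^ yleaf T) (y₁ ^ oint T) (y₂ ^ yint T) x₂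
    where
      T : PlaneTree
      T = node (c ∷ cs)

  wt-graft : ∀ c {d} cs → NonLeaf d → wt (node (c ∷ d ∷ cs)) ≈ wt (node (c ∷ cs)) * wt d
  wt-graft c {d} cs node∷ = trans
    (wt≈monomial (node (c ∷ d ∷ cs))
      (rearrange (leafInd c) (oleaf c) (oleaf d) (oleafL cs)) (rearrange (countLeafRoots cs) (yleaf c) (yleaf d) (yleafL cs))
      (rearrange (leafInd c) (oint c) (oint d) (ointL cs)) (rearrange (nonLeafInd c) (yint c) (yint d) (yintL cs)))
    (monomial-+ (oleaf T) (yleaf T) (oint T) (yint T) (oleaf d) (yleaf d) (oint d) (yint d))
    where
      T : PlaneTree
      T = node (c ∷ cs)
      rearrange : ∀ w x y z → w ℕ.+ (x ℕ.+ (y ℕ.+ z)) ≡ (w ℕ.+ (x ℕ.+ z)) ℕ.+ y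
      rearrange = solve-∀

  forestWeight : List PlaneTree → A
  forestWeight []      = 1#
  forestWeight (t ∷ f) = wt t * forestWeight f

  forestWeight-consStick : ∀ f → forestWeight (consStick f) ≈ u * forestWeight f
  forestWeight-consStick f = *-congʳ wt-stick

  forestWeight-plantFirst : ∀ {n s f} → IsForest n (suc s) f → forestWeight (plantFirst f) ≈ y₂ * forestWeight f
  forestWeight-plantFirst {f = c ∷ f} (forest _ (c-nonLeaf ∷ _) _) =
    trans (*-congʳ (wt-plant c-nonLeaf)) (*-assoc _ _ _)

  forestWeight-addYoungLeaf : ∀ {n s f} → IsForest n (suc s) f → forestWeight (addYoungLeaf f) ≈ x₂ * forestWeight f
  forestWeight-addYoungLeaf {f = node (c ∷ cs) ∷ f} (forest _ (node∷ ∷ _) _) =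
    trans (*-congʳ (wt-addYoungLeaf c cs)) (*-assoc _ _ _)

  forestWeight-graftSecond : ∀ {n s f} → IsForest n (2 ℕ.+ s) f → forestWeight (graftSecond f) ≈ forestWeight f
  forestWeight-graftSecond {f = node (c ∷ cs) ∷ d ∷ f} (forest _ (node∷ ∷ d-nonLeaf ∷ _) _) =
    trans (*-congʳ (wt-graft c cs d-nonLeaf)) (*-assoc _ _ _)

  forestSum : ℕ → ℕ → A
  forestSum n s = sumList forestWeight (forests n s)

  forestSum-suc : ∀ n s →
    forestSum (suc n) (suc s) ≈ u * forestSum n s + ((x₂ + y₂) * forestSum n (suc s) + forestSum n (2 ℕ.+ s))
  forestSum-suc n s = begin
    forestSum (suc n) (suc s)
      ≈⟨ sumList-concat forestWeight (forestsByMove n s) ⟩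
    sumList (sumList forestWeight) (forestsByMove n s)
      ≈⟨ +-cong (scaled (All.universal forestWeight-consStick (forests n s)))
        (+-cong (scaled (All.map forestWeight-plantFirst (forests-sound n (suc s))))
        (+-cong (scaled (All.map forestWeight-addYoungLeaf (forests-sound n (suc s))))
        (+-congʳ (sumList-map (All.map forestWeight-graftSecond (forests-sound n (2 ℕ.+ s))))))) ⟩
    u * S₀ + (y₂ * S₁ + (x₂ * S₁ + (S₂ + 0#)))
      ≈⟨ solve 6 (λ u x y a b c → u :* a :+ (y :* b :+ (x :* b :+ (c :+ con 0))) := u :* a :+ ((x :+ y) :* b :+ c))
               refl u x₂ y₂ S₀ S₁ S₂ ⟩
    u * S₀ + ((x₂ + y₂) * S₁ + S₂) ∎
    where
      S₀ S₁ S₂ : A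
      S₀ = forestSum n s
      S₁ = forestSum n (suc s)
      S₂ = forestSum n (2 ℕ.+ s)
      scaled : ∀ {a h xs} → All (λ f → forestWeight (h f) ≈ a * forestWeight f) xs →
               sumList forestWeight (map h xs) ≈ a * sumList forestWeight xs
      scaled {a} {xs = xs} p = trans (sumList-map p) (sym (*-distribˡ-sumList a forestWeight xs))

  forestSum≈u*motzkinPaths : ∀ n h → forestSum (suc n) (suc h) ≈ u * motzkinPaths (x₂ + y₂) n h
  forestSum≈u*motzkinPaths zero zero = trans (forestSum-suc 0 0)
    (solve 3 (λ u x y → u :* (con 1 :+ con 0) :+ ((x :+ y) :* con 0 :+ con 0) := u :* con 1) refl u x₂ y₂)
  forestSum≈u*motzkinPaths zero (suc h) = trans (forestSum-suc 0 (suc h))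
    (solve 3 (λ u x y → u :* con 0 :+ ((x :+ y) :* con 0 :+ con 0) := u :* con 0) refl u x₂ y₂)
  forestSum≈u*motzkinPaths (suc n) zero = begin
    forestSum (2 ℕ.+ n) 1
      ≈⟨ forestSum-suc (suc n) 0 ⟩
    u * 0# + (v * forestSum (suc n) 1 + forestSum (suc n) 2)
      ≈⟨ +-congˡ (+-cong (*-congˡ (forestSum≈u*motzkinPaths n 0)) (forestSum≈u*motzkinPaths n 1)) ⟩
    u * 0# + (v * (u * P n 0) + u * P n 1)
      ≈⟨ solve 4 (λ u v p₀ p₁ → u :* con 0 :+ (v :* (u :* p₀) :+ u :* p₁) := u :* (v :* p₀ :+ p₁))
               refl u v (P n 0) (P n 1) ⟩
    u * P (suc n) 0 ∎
    where
      v : A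
      v = x₂ + y₂
      P : ℕ → ℕ → A
      P = motzkinPaths v
  forestSum≈u*motzkinPaths (suc n) (suc h) = begin
    forestSum (2 ℕ.+ n) (2 ℕ.+ h)
      ≈⟨ forestSum-suc (suc n) (suc h) ⟩
    u * forestSum (suc n) (suc h) + (v * forestSum (suc n) (2 ℕ.+ h) + forestSum (suc n) (3 ℕ.+ h))
      ≈⟨ +-cong (*-congˡ (forestSum≈u*motzkinPaths n h))
                (+-cong (*-congˡ (forestSum≈u*motzkinPaths n (suc h))) (forestSum≈u*motzkinPaths n (2 ℕ.+ h))) ⟩
    u * (u * P n h) + (v * (u * P n (suc h)) + u * P n (2 ℕ.+ h))
      ≈⟨ solve 5 (λ u v p₀ p₁ p₂ → u :* (u :* p₀) :+ (v :* (u :* p₁) :+ u :* p₂)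
                                  := u :* (u :* p₀ :+ (v :* p₁ :+ p₂)))
               refl u v (P n h) (P n (suc h)) (P n (2 ℕ.+ h)) ⟩
    u * P (suc n) (suc h) ∎
    where
      v : A
      v = x₂ + y₂
      P : ℕ → ℕ → A
      P = motzkinPaths v

  G≈forestSum : ∀ {n Ps} → (∀ {T} → T ∈ Ps → edges T ≡ suc n) → (∀ {T} → edges T ≡ suc n → T ∈ Ps) →
                Unique Ps → G Ps x₁ x₂ y₁ y₂ ≈ forestSum (suc n) 1
  G≈forestSum {n} {Ps} ∈⇒edges edges⇒∈ Ps-unique = begin
    sumList wt Ps                      ≈⟨ sumList-map (All.universal (λ T → *-identityʳ (wt T)) Ps) ⟨
    sumList forestWeight (map [_] Ps)  ≈⟨ sumList-↭ forestWeight (singletons↭forests ∈⇒edges edges⇒∈ Ps-unique) ⟩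
    forestSum (suc n) 1                ∎

open import Data.Product.Base using (_×_; proj₁; proj₂)

corollary1p15 : {c ℓ : Level} (R : CommutativeSemiring c ℓ) →
    let open CommutativeSemiring R in
    (n : ℕ) (Ps : List PlaneTree) →
    ((T : PlaneTree) → (T ∈ Ps → edges T ≡ suc n) × (edges T ≡ suc n → T ∈ Ps)) →
    Unique Ps →
    (x₁ x₂ y₁ y₂ : Carrier) →
    Poly.G R Ps x₁ x₂ y₁ y₂
      ≈ Poly.sumUpTo R
          (λ i → RS._×_ rawSemiring (n C i) (RS._^_ rawSemiring y₂ i * Poly.motzkin R (n ∸ i) (x₁ * y₁) x₂))
          n
corollary1p15 R n Ps enumerates Ps-unique x₁ x₂ y₁ y₂ = begin
  G Ps x₁ x₂ y₁ y₂
    ≈⟨ G≈forestSum (proj₁ (enumerates _)) (proj₂ (enumerates _)) Ps-unique ⟩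
  forestSum (suc n) 1
    ≈⟨ forestSum≈u*motzkinPaths n 0 ⟩
  u * motzkinPaths (x₂ + y₂) n 0
    ≈⟨ *-congˡ (motzkinPaths-split refl n 0) ⟩
  u * binomialConv (λ m → motzkinPaths x₂ m 0) (y₂ ^_) n
    ≈⟨ binomialConv-*ˡ u _ (y₂ ^_) n ⟨
  binomialConv (λ m → u * motzkinPaths x₂ m 0) (y₂ ^_) n
    ≈⟨ binomialConv-congˡ (y₂ ^_) n (u*motzkinPaths≈motzkin x₂) ⟩
  binomialConv (λ m → motzkin m u x₂) (y₂ ^_) n
    ≈⟨ binomialConv-comm _ (y₂ ^_) n ⟩
  binomialConv (y₂ ^_) (λ m → motzkin m u x₂) n ∎
  where
    open CommutativeSemiring R
    open Poly R using (G; motzkin)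
    open SemiringSums R
    open MotzkinPaths R (x₁ * y₁)
    open ForestWeights R x₁ x₂ y₁ y₂
    open RS rawSemiring using (_^_)
    open import Relation.Binary.Reasoning.Setoid setoid
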